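{- Let $C^\tau=(V,E,\tau)$ be an edge-periodic cycle on $n$ vertices and $L=\{l_e: e\in E\}$. Let $l=1$ if $\mathsf{LCM}(L)\ge 2\cdot\max L$, and $l=2$ otherwise. If $n\ge 2\cdot l\cdot\mathsf{LCM}(L)$, then $C^\tau$ is robber-win.
   Context: An edge-periodic graph $G^\tau=(V,E,\tau)$ is a finite simple graph $(V,E)$ with time steps $t=0,1,2,\dots$ and a map $\tau$ assigning each edge $e$ a bit pattern $b_e(0)\cdots b_e(l_e-1)$ of length $l_e\ge1$ containing at least one $1$; $e$ is present in step $t$ iff $b_e(t\bmod l_e)=1$. An edge-periodic cycle is one whose underlying graph is a cycle. $\mathsf{LCM}(L)$ is the least common multiple of $L$. Game: the cop chooses a start vertex, then the robber (knowing it) chooses one; in each time step $t=0,1,2,\dots$, first the cop then the robber moves, each either staying put or traversing an incident edge present in step $t$, with full information. The cop wins as soon as both occupy the same vertex at the end of a move. The graph is robber-win if the robber has a strategy to avoid this forever. -}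

module Defs where

open import Data.Nat using (ℕ; zero; suc; _+_; _*_; _≤_; _⊔_; _≤ᵇ_; NonZero)
open import Data.Nat.LCM using (lcm)
open import Data.Nat.DivMod using (_mod_)
open import Data.Bool using (Bool; true; false)
open import Data.Fin using (Fin; toℕ)
open import Data.Vec using (Vec; lookup; _∷_; []; head)
open import Data.Vec.Relation.Unary.Any using (Any)
open import Data.List using (List; map; foldr)
open import Data.List.Base using (allFin)
open import Data.Product using (Σ; ∃; _×_; _,_; proj₁; proj₂)
open import Data.Sum using (_⊎_)
open import Relation.Binary.PropositionalEquality using (_≡_; _≢_)
open import Relation.Nullary using (¬_)

-- A bit pattern b(0)…b(len-1) of length len ≥ 1 containing at least one 1.
-- The length is stored as suc lenPred so that len ≥ 1 by construction.
record Pattern : Set where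
  constructor mkPattern
  field
    lenPred : ℕ
    bits    : Vec Bool (suc lenPred)
    hasOne  : Any (_≡ true) bits

len : Pattern → ℕ
len p = suc (Pattern.lenPred p)

present : Pattern → ℕ → Set
present p t = lookup (Pattern.bits p) (t mod len p) ≡ true

-- Cycle on n vertices: vertices Fin n, edge i joins i and (i+1) mod n.
-- An edge-periodic cycle assigns a pattern to each edge.
EdgePeriodicCycle : ℕ → Set
EdgePeriodicCycle n = Fin n → Pattern

next : {n : ℕ} → Fin n → Fin n
next {suc m} i = suc (toℕ i) mod suc m

lengths : {n : ℕ} → EdgePeriodicCycle n → List ℕ
lengths {n} τ = map (λ e → len (τ e)) (allFin n)

LCM : List ℕ → ℕ
LCM = foldr lcm 1

maxL : List ℕ → ℕ
maxL = foldr _⊔_ 0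

EdgeAt : {n : ℕ} → EdgePeriodicCycle n → ℕ → Fin n → Fin n → Set
EdgeAt τ t u v = Σ _ λ e → present (τ e) t × ((u ≡ e × v ≡ next e) ⊎ (u ≡ next e × v ≡ e))

Move : {n : ℕ} → EdgePeriodicCycle n → ℕ → Fin n → Fin n → Set
Move τ t u v = u ≡ v ⊎ EdgeAt τ t u v

-- Histories: the (cop, robber) positions at the start of steps t, t-1, …, 0 (most recent first).
History : ℕ → ℕ → Set
History n t = Vec (Fin n × Fin n) (suc t)

CopStrategy : ℕ → Set
CopStrategy n = (t : ℕ) → History n t → Fin n

-- Robber strategy: in step t, given the full history and the cop's move in step t, the robber's new position.
RobberStrategy : ℕ → Set
RobberStrategy n = (t : ℕ) → History n t → Fin n → Fin n

play : {n : ℕ} → Fin n → Fin n → CopStrategy n → RobberStrategy n → (t : ℕ) → History n t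
play c₀ r₀ σ ρ zero = (c₀ , r₀) ∷ []
play c₀ r₀ σ ρ (suc t) =
  let h  = play c₀ r₀ σ ρ t
      c' = σ t h
  in (c' , ρ t h c') ∷ h

CopLegalUpTo : {n : ℕ} → EdgePeriodicCycle n → Fin n → Fin n → CopStrategy n → RobberStrategy n → ℕ → Set
CopLegalUpTo τ c₀ r₀ σ ρ t =
  (s : ℕ) → s ≤ t → Move τ s (proj₁ (head (play c₀ r₀ σ ρ s))) (σ s (play c₀ r₀ σ ρ s))

RobberWin : {n : ℕ} → EdgePeriodicCycle n → Set
RobberWin {n} τ =
  (c₀ : Fin n) → Σ (Fin n) λ r₀ → Σ (RobberStrategy n) λ ρ →
    r₀ ≢ c₀ ×
    ((σ : CopStrategy n) (t : ℕ) → CopLegalUpTo τ c₀ r₀ σ ρ t →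
      let h  = play c₀ r₀ σ ρ t
          r  = proj₂ (head h)
          c' = σ t h
          r' = ρ t h c'
      in c' ≢ r × Move τ t r r' × r' ≢ c')

ell : List ℕ → ℕ
ell L with 2 * maxL L ≤ᵇ LCM L
... | true  = 1
... | false = 2

-- Put K = ell(L) · LCM(L).  Every edge length divides K (so every edge
-- pattern is K-periodic) and is smaller than K (this is what ell is for),
-- and the cycle has at least 2K vertices.  The robber starts K steps
-- clockwise from the cop.  For each direction d of travel we keep the
-- invariant "the robber is ahead in direction d": however the cop walks
-- along d to the robber's vertex, the robber can leave that vertex along
-- d at least K steps before the cop could.  The robber flees along d
-- exactly when the cop is fewer than K steps behind it in direction d and
-- the edge ahead is present; otherwise it waits.  Each rule preserves both
-- invariants, and the invariants forbid a capture.
module Submission where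

open import Data.Bool using (true; false; T)
import Data.Bool as Bool
open import Data.Empty using (⊥-elim)
open import Data.Fin using (Fin; toℕ; fromℕ<) renaming (zero to fzero)
open import Data.Fin.Properties using (toℕ-fromℕ<; toℕ-injective; toℕ<n; any?)
  renaming (_≟_ to _≟ᶠ_)
open import Data.List using (List; []; _∷_)
open import Data.List.Membership.Propositional using (_∈_)
open import Data.List.Membership.Propositional.Properties using (∈-map⁺; ∈-map⁻; ∈-allFin)
open import Data.List.Relation.Unary.Any using (here; there)
open import Data.Nat
open import Data.Nat.Properties
open import Data.Nat.DivMod
  using (_%_; _mod_; m%n<n; m<n⇒m%n≡m; [m+n]%n≡m%n; [m+kn]%n≡m%n; %-distribˡ-+;
         m%n%n≡m%n; m≤n⇒[n∸m]%m≡n%m; %-remove-+ʳ)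
open import Data.Nat.Divisibility using (_∣_; ∣-trans; ∣-refl; ∣⇒≤; n∣m*n)
open import Data.Nat.GCD using (gcd)
open import Data.Nat.LCM using (lcm; gcd*lcm; m∣lcm[m,n]; n∣lcm[m,n])
open import Data.Product using (∃; _×_; _,_; proj₁; proj₂)
open import Data.Sum using (_⊎_; inj₁; inj₂)
open import Data.Unit using (tt)
open import Data.Vec using (lookup; head)
open import Data.Vec.Relation.Unary.Any using (index)
open import Data.Vec.Relation.Unary.Any.Properties using (lookup-index)
open import Function using (_∘_)
open import Relation.Nullary using (Dec; yes; no; ¬_)
open import Relation.Nullary.Decidable using (_×-dec_)
open import Relation.Binary.PropositionalEquality
open import Defs

iterate : {A : Set} → (A → A) → ℕ → A → A
iterate f zero x = x
iterate f (suc k) x = iterate f k (f x)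

iterate-suc : {A : Set} (f : A → A) (k : ℕ) (x : A) → iterate f (suc k) x ≡ f (iterate f k x)
iterate-suc f zero x = refl
iterate-suc f (suc k) x = iterate-suc f k (f x)

iterate-+ : {A : Set} (f : A → A) (a b : ℕ) (x : A) →
            iterate f (a + b) x ≡ iterate f b (iterate f a x)
iterate-+ f zero b x = refl
iterate-+ f (suc a) b x = iterate-+ f a b (f x)

iterate-undo : {A : Set} (f g : A → A) → (∀ x → f (g x) ≡ x) →
               ∀ k {x y} → iterate g k x ≡ y → iterate f k y ≡ x
iterate-undo f g fg zero gx≡y = sym gx≡y
iterate-undo f g fg (suc k) {x} {y} gx≡y = begin
  iterate f (suc k) y  ≡⟨ iterate-suc f k y ⟩
  f (iterate f k y)    ≡⟨ cong f (iterate-undo f g fg k gx≡y) ⟩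
  f (g x)              ≡⟨ fg x ⟩
  x                    ∎
  where open ≡-Reasoning

module Cycle (m : ℕ) where

  N : ℕ
  N = suc m

  iterate-next-toℕ : ∀ k (x : Fin N) → toℕ (iterate next k x) ≡ (toℕ x + k) % N
  iterate-next-toℕ zero x =
    sym (trans (cong (_% N) (+-identityʳ (toℕ x))) (m<n⇒m%n≡m (toℕ<n x)))
  iterate-next-toℕ (suc k) x = begin
    toℕ (iterate next k (next x))  ≡⟨ iterate-next-toℕ k (next x) ⟩
    (toℕ (next x) + k) % N         ≡⟨ cong (λ y → (y + k) % N) (toℕ-fromℕ< (m%n<n (suc (toℕ x)) N)) ⟩
    (suc (toℕ x) % N + k) % N      ≡⟨ %-absorb (suc (toℕ x)) ⟩
    (suc (toℕ x) + k) % N          ≡⟨ cong (_% N) (sym (+-suc (toℕ x) k)) ⟩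
    (toℕ x + suc k) % N            ∎
    where
    open ≡-Reasoning
    %-absorb : ∀ a → (a % N + k) % N ≡ (a + k) % N
    %-absorb a = begin
      (a % N + k) % N          ≡⟨ %-distribˡ-+ (a % N) k N ⟩
      (a % N % N + k % N) % N  ≡⟨ cong (λ y → (y + k % N) % N) (m%n%n≡m%n a N) ⟩
      (a % N + k % N) % N      ≡⟨ %-distribˡ-+ a k N ⟨
      (a + k) % N              ∎

  +-mod-moves : ∀ {a k} → a < N → 0 < k → k < N → (a + k) % N ≢ a
  +-mod-moves {a} {k} a<N 0<k k<N wraps with a + k <? N
  ... | yes a+k<N = <-irrefl (sym (trans (sym (m<n⇒m%n≡m a+k<N)) wraps)) (m<m+n a 0<k)
  ... | no a+k≮N = <-irrefl k≡N k<N
    where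
    open ≡-Reasoning
    N≤a+k : N ≤ a + k
    N≤a+k = ≮⇒≥ a+k≮N
    a+k∸N≡a : a + k ∸ N ≡ a
    a+k∸N≡a = begin
      a + k ∸ N        ≡⟨ m<n⇒m%n≡m (m<n+o⇒m∸n<o (a + k) N (+-mono-< a<N k<N)) ⟨
      (a + k ∸ N) % N  ≡⟨ m≤n⇒[n∸m]%m≡n%m N≤a+k ⟩
      (a + k) % N      ≡⟨ wraps ⟩
      a                ∎
    k≡N : k ≡ N
    k≡N = +-cancelˡ-≡ a k N (begin
      a + k          ≡⟨ m∸n+n≡m N≤a+k ⟨
      a + k ∸ N + N  ≡⟨ cong (_+ N) a+k∸N≡a ⟩
      a + N          ∎)

  next-aperiodic : ∀ {k} (x : Fin N) → 0 < k → k < N → iterate next k x ≢ x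
  next-aperiodic {k} x 0<k k<N loop =
    +-mod-moves (toℕ<n x) 0<k k<N (trans (sym (iterate-next-toℕ k x)) (cong toℕ loop))

  next-period : ∀ (x : Fin N) → iterate next N x ≡ x
  next-period x = toℕ-injective (begin
    toℕ (iterate next N x)  ≡⟨ iterate-next-toℕ N x ⟩
    (toℕ x + N) % N         ≡⟨ [m+n]%n≡m%n (toℕ x) N ⟩
    toℕ x % N               ≡⟨ m<n⇒m%n≡m (toℕ<n x) ⟩
    toℕ x                   ∎)
    where open ≡-Reasoning

  prev : Fin N → Fin N
  prev = iterate next m

  next-prev : ∀ x → next (prev x) ≡ x
  next-prev x = trans (sym (iterate-suc next m x)) (next-period x)

  prev-next : ∀ x → prev (next x) ≡ x
  prev-next = next-period

Move-sym : ∀ {n} {τ : EdgePeriodicCycle n} {t u v} → Move τ t u v → Move τ t v u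
Move-sym (inj₁ u≡v) = inj₁ (sym u≡v)
Move-sym (inj₂ (e , pe , inj₁ (u≡e , v≡e'))) = inj₂ (e , pe , inj₂ (v≡e' , u≡e))
Move-sym (inj₂ (e , pe , inj₂ (u≡e' , v≡e))) = inj₂ (e , pe , inj₁ (v≡e , u≡e'))

module FirstPresence (p : Pattern) where
  open Pattern p using (bits; hasOne)

  present? : ∀ t → Dec (present p t)
  present? t = lookup bits (t mod len p) Bool.≟ true

  present-at : ∀ u {i} → u % len p ≡ toℕ i → lookup bits i ≡ true → present p u
  present-at u u%≡i bit = trans (cong (lookup bits) (toℕ-injective (trans (toℕ-fromℕ< (m%n<n u (len p))) u%≡i))) bit

  present-mod : ∀ {u v} → u % len p ≡ v % len p → present p u → present p v
  present-mod {u} {v} u%≡v% = present-at v (trans (sym u%≡v%) (sym (toℕ-fromℕ< (m%n<n u (len p)))))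

  -- Some step ≥ t is present: shift a 1 of the pattern by t whole periods.
  presentFrom : ∀ t → ∃ λ u → t ≤ u × present p u
  presentFrom t = i + t * len p , ≤-trans (m≤m*n t (len p)) (m≤n+m (t * len p) i) ,
                  present-at (i + t * len p) i-residue (lookup-index hasOne)
    where
    i : ℕ
    i = toℕ (index hasOne)
    i-residue : (i + t * len p) % len p ≡ i
    i-residue = trans ([m+kn]%n≡m%n i t (len p)) (m<n⇒m%n≡m (toℕ<n (index hasOne)))

  firstFrom : ℕ → ℕ → ℕ
  firstFrom t zero = t
  firstFrom t (suc f) with present? t
  ... | yes _ = t
  ... | no _ = firstFrom (suc t) f

  record IsFirst (t s : ℕ) : Set where
    field
      after     : t ≤ s
      isPresent : present p s
      least     : ∀ {u} → t ≤ u → present p u → s ≤ u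

  firstFrom-isFirst : ∀ f {t w} → t ≤ w → w < t + f → present p w → IsFirst t (firstFrom t f)
  firstFrom-isFirst zero {t} t≤w w<t+0 _ = ⊥-elim (<⇒≱ w<t+0 (≤-trans (≤-reflexive (+-identityʳ t)) t≤w))
  firstFrom-isFirst (suc f) {t} {w} t≤w w<t+f pw with present? t
  ... | yes pt = record { after = ≤-refl ; isPresent = pt ; least = λ t≤u _ → t≤u }
  ... | no ¬pt = record { after = ≤-trans (n≤1+n t) (IsFirst.after rest)
                        ; isPresent = IsFirst.isPresent rest
                        ; least = λ t≤u pu → IsFirst.least rest (skip t≤u pu) pu }
    where
    skip : ∀ {u} → t ≤ u → present p u → suc t ≤ u
    skip t≤u pu = ≤∧≢⇒< t≤u (λ t≡u → ¬pt (subst (present p) (sym t≡u) pu))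
    rest : IsFirst (suc t) (firstFrom (suc t) f)
    rest = firstFrom-isFirst f (skip t≤w pw) (subst (w <_) (+-suc t f) w<t+f) pw

  -- The first present step at or after t; the window reaches a known present step.
  firstPresent : ℕ → ℕ
  firstPresent t = firstFrom t (suc (proj₁ (presentFrom t)))

  firstPresent-isFirst : ∀ t → IsFirst t (firstPresent t)
  firstPresent-isFirst t = firstFrom-isFirst (suc w) (proj₁ (proj₂ (presentFrom t)))
                             (m≤n+m (suc w) t) (proj₂ (proj₂ (presentFrom t)))
    where
    w : ℕ
    w = proj₁ (presentFrom t)

  firstPresent-≥ : ∀ t → t ≤ firstPresent t
  firstPresent-≥ t = IsFirst.after (firstPresent-isFirst t)

  firstPresent-present : ∀ t → present p (firstPresent t)
  firstPresent-present t = IsFirst.isPresent (firstPresent-isFirst t)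

  firstPresent-least : ∀ {t u} → t ≤ u → present p u → firstPresent t ≤ u
  firstPresent-least {t} = IsFirst.least (firstPresent-isFirst t)

  firstPresent-mono : ∀ {t t'} → t ≤ t' → firstPresent t ≤ firstPresent t'
  firstPresent-mono {t} {t'} t≤t' =
    firstPresent-least (≤-trans t≤t' (firstPresent-≥ t')) (firstPresent-present t')

  firstPresent-here : ∀ {t} → present p t → firstPresent t ≡ t
  firstPresent-here {t} pt = ≤-antisym (firstPresent-least ≤-refl pt) (firstPresent-≥ t)

  firstPresent-absent : ∀ {t} → ¬ present p t → firstPresent (suc t) ≡ firstPresent t
  firstPresent-absent {t} ¬pt = ≤-antisym
    (firstPresent-least t<first (firstPresent-present t)) (firstPresent-mono (n≤1+n t))
    where
    t<first : suc t ≤ firstPresent t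
    t<first = ≤∧≢⇒< (firstPresent-≥ t) (λ t≡s → ¬pt (subst (present p) (sym t≡s) (firstPresent-present t)))

  firstPresent-period : ∀ t → firstPresent (suc t) ≤ firstPresent t + len p
  firstPresent-period t = firstPresent-least
    (≤-trans (s≤s (firstPresent-≥ t)) (m<m+n (firstPresent t) z<s))
    (present-mod {firstPresent t} {firstPresent t + len p} (sym (%-remove-+ʳ (firstPresent t) (∣-refl {len p}))) (firstPresent-present t))

  firstPresent-shift : ∀ {K} t → len p ∣ K → firstPresent t + K ≤ firstPresent (t + K)
  firstPresent-shift {K} t len∣K = begin
    firstPresent t + K  ≤⟨ +-monoˡ-≤ K (firstPresent-least t≤s∸K present-s∸K) ⟩
    s ∸ K + K           ≡⟨ m∸n+n≡m K≤s ⟩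
    s                   ∎
    where
    open ≤-Reasoning
    s : ℕ
    s = firstPresent (t + K)
    K≤s : K ≤ s
    K≤s = ≤-trans (m≤n+m K t) (firstPresent-≥ (t + K))
    t≤s∸K : t ≤ s ∸ K
    t≤s∸K = subst (_≤ s ∸ K) (m+n∸n≡m t K) (∸-monoˡ-≤ K (firstPresent-≥ (t + K)))
    present-s∸K : present p (s ∸ K)
    present-s∸K = present-mod {s ∸ K + K} {s ∸ K} (%-remove-+ʳ (s ∸ K) len∣K)
      (subst (present p) (sym (m∸n+n≡m K≤s)) (firstPresent-present (t + K)))

module Chase (m : ℕ) (τ : EdgePeriodicCycle (suc m)) (K : ℕ)
             (len∣K : ∀ e → len (τ e) ∣ K) (len<K : ∀ e → len (τ e) < K)
             (2K≤N : 2 * K ≤ suc m) where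

  open Cycle m
  module FP (e : Fin N) = FirstPresence (τ e)

  first : Fin N → ℕ → ℕ
  first e = FP.firstPresent e

  0<K : 0 < K
  0<K = ≤-trans (s≤s z≤n) (len<K fzero)

  K+K≤N : K + K ≤ N
  K+K≤N = subst (_≤ N) (cong (K +_) (+-identityʳ K)) 2K≤N

  Far : (Fin N → Fin N) → Fin N → Fin N → Set
  Far f c r = ∀ k → iterate f k c ≡ r → K ≤ k

  far⇒distinct : ∀ {f c r} → Far f c r → c ≢ r
  far⇒distinct far c≡r = <⇒≱ 0<K (far 0 c≡r)

  -- A direction of travel around the cycle: a step map, its inverse, and
  -- the edge that each step crosses.
  record Direction : Set where
    field
      step back edge : Fin N → Fin N
      step-back      : ∀ x → step (back x) ≡ x
      back-step      : ∀ x → back (step x) ≡ x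
      step-aperiodic : ∀ {k} x → 0 < k → k < N → iterate step k x ≢ x
      step-legal     : ∀ {t} x → present (τ (edge x)) t → Move τ t x (step x)

  clockwise : Direction
  clockwise = record
    { step = next ; back = prev ; edge = λ x → x
    ; step-back = next-prev ; back-step = prev-next
    ; step-aperiodic = next-aperiodic
    ; step-legal = λ x px → inj₂ (x , px , inj₁ (refl , refl)) }

  reverse : Direction → Direction
  reverse d = record
    { step = back ; back = step ; edge = λ x → edge (back x)
    ; step-back = back-step ; back-step = step-back
    ; step-aperiodic = λ {k} x 0<k k<N loop → step-aperiodic x 0<k k<N (iterate-undo step back step-back k loop)
    ; step-legal = λ {t} x px → subst (λ y → Move τ t y (back x)) (step-back x)
                                  (Move-sym {τ = τ} {t} {back x} {step (back x)} (step-legal {t} (back x) px)) }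
    where open Direction d

  counterclockwise : Direction
  counterclockwise = reverse clockwise

  module Pursuit (d : Direction) where
    open Direction d

    step-injective : ∀ {x y} → step x ≡ step y → x ≡ y
    step-injective {x} {y} sx≡sy = trans (sym (back-step x)) (trans (cong back sx≡sy) (back-step y))

    -- arrival x t k: when a walker standing on x at step t, crossing k edges
    -- along d each as soon as it is present, reaches iterate step k x.
    arrival : Fin N → ℕ → ℕ → ℕ
    arrival x t zero = t
    arrival x t (suc k) = arrival (step x) (suc (first (edge x) t)) k

    arrival-mono : ∀ x {t t'} k → t ≤ t' → arrival x t k ≤ arrival x t' k
    arrival-mono x zero t≤t' = t≤t'
    arrival-mono x (suc k) t≤t' = arrival-mono (step x) k (s≤s (FP.firstPresent-mono (edge x) t≤t'))

    arrival-≥ : ∀ x t k → t + k ≤ arrival x t k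
    arrival-≥ x t zero = ≤-reflexive (+-identityʳ t)
    arrival-≥ x t (suc k) = begin
      t + suc k                   ≡⟨ +-suc t k ⟩
      suc t + k                   ≤⟨ +-monoˡ-≤ k (s≤s (FP.firstPresent-≥ (edge x) t)) ⟩
      suc (first (edge x) t) + k  ≤⟨ arrival-≥ (step x) _ k ⟩
      arrival x t (suc k)         ∎
      where open ≤-Reasoning

    arrival-last : ∀ x t k → arrival x t (suc k) ≡ suc (first (edge (iterate step k x)) (arrival x t k))
    arrival-last x t zero = refl
    arrival-last x t (suc k) = arrival-last (step x) _ k

    -- The invariant, for the cop on c and the robber on r at step t: along
    -- every walk of the cop to r, the robber can leave r along d at least K
    -- steps before the cop can.
    Ahead : ℕ → Fin N → Fin N → Set
    Ahead t c r = ∀ k → iterate step k c ≡ r → first (edge r) t + K ≤ first (edge r) (arrival c t k)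

    -- A robber at least K steps ahead is ahead, since the patterns are K-periodic.
    far⇒ahead : ∀ {c r} t → Far step c r → Ahead t c r
    far⇒ahead {c} {r} t far k reach = begin
      first (edge r) t + K            ≤⟨ FP.firstPresent-shift (edge r) t (len∣K (edge r)) ⟩
      first (edge r) (t + K)          ≤⟨ FP.firstPresent-mono (edge r) (≤-trans (+-monoʳ-≤ t (far k reach)) (arrival-≥ c t k)) ⟩
      first (edge r) (arrival c t k)  ∎
      where open ≤-Reasoning

    -- The walk of length 0 shows that cop and robber are apart.
    ahead⇒distinct : ∀ {t c r} → Ahead t c r → c ≢ r
    ahead⇒distinct {t} {c} {r} ahead c≡r = <⇒≱ (m<m+n (first (edge r) t) 0<K) (ahead 0 c≡r)

    -- The walk of length 1 shows that the cop cannot step along d onto the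
    -- robber: the edges have length < K.
    ahead⇒no-capture : ∀ {t c r} → Ahead t c r → present (τ (edge c)) t → step c ≢ r
    ahead⇒no-capture {t} {c} {r} ahead pc sc≡r =
      <⇒≱ (+-monoʳ-< (first (edge r) t) (len<K (edge r))) (begin
        first (edge r) t + K                ≤⟨ ahead 1 sc≡r ⟩
        first (edge r) (arrival c t 1)      ≡⟨ cong (λ s → first (edge r) (suc s)) (FP.firstPresent-here (edge c) pc) ⟩
        first (edge r) (suc t)              ≤⟨ FP.firstPresent-period (edge r) t ⟩
        first (edge r) t + len (τ (edge r)) ∎)
      where open ≤-Reasoning

    CopStep : ℕ → Fin N → Fin N → Set
    CopStep t c c' = c' ≡ c ⊎ (c' ≡ step c × present (τ (edge c)) t) ⊎ c' ≡ back c

    cop-step-arrival : ∀ {t c c' r} → CopStep t c c' → c' ≢ r → ∀ k' → iterate step k' c' ≡ r →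
                       ∃ λ k → iterate step k c ≡ r × arrival c t k ≤ arrival c' (suc t) k'
    cop-step-arrival (inj₁ refl) _ k' reach = k' , reach , arrival-mono _ k' (n≤1+n _)
    cop-step-arrival {t} {c} (inj₂ (inj₁ (refl , pc))) _ k' reach = suc k' , reach ,
      ≤-reflexive (cong (λ s → arrival (step c) (suc s) k') (FP.firstPresent-here (edge c) pc))
    cop-step-arrival (inj₂ (inj₂ refl)) c'≢r zero reach = ⊥-elim (c'≢r reach)
    cop-step-arrival {t} {c} (inj₂ (inj₂ refl)) _ (suc k) reach =
      k , subst (λ y → iterate step k y ≡ _) (step-back c) reach ,
      subst (λ y → arrival c t k ≤ arrival y t' k) (sym (step-back c)) (arrival-mono c k t≤t')
      where
      t' : ℕ
      t' = suc (first (edge (back c)) (suc t))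
      t≤t' : t ≤ t'
      t≤t' = m≤n⇒m≤1+n (≤-trans (n≤1+n t) (FP.firstPresent-≥ (edge (back c)) (suc t)))

    ahead-wait : ∀ {t c c' r} → Ahead t c r → CopStep t c c' → c' ≢ r →
                 ¬ present (τ (edge r)) t → Ahead (suc t) c' r
    ahead-wait {t} {c} {c'} {r} ahead cop c'≢r absent k' reach with cop-step-arrival cop c'≢r k' reach
    ... | k , reach₀ , slower = begin
      first (edge r) (suc t) + K               ≡⟨ cong (_+ K) (FP.firstPresent-absent (edge r) absent) ⟩
      first (edge r) t + K                     ≤⟨ ahead k reach₀ ⟩
      first (edge r) (arrival c t k)           ≤⟨ FP.firstPresent-mono (edge r) slower ⟩
      first (edge r) (arrival c' (suc t) k')   ∎
      where open ≤-Reasoning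

    -- Crossing the present edge along d keeps the robber ahead: the cop
    -- crosses the same edge at least K steps later.
    ahead-cross : ∀ {t c c' r} → Ahead t c r → CopStep t c c' → c' ≢ r →
                  present (τ (edge r)) t → c' ≢ step r → Ahead (suc t) c' (step r)
    ahead-cross _ _ _ _ c'≢r' zero reach = ⊥-elim (c'≢r' reach)
    ahead-cross {t} {c} {c'} {r} ahead cop c'≢r pr _ (suc j) reach = begin
      first e' (suc t) + K                      ≤⟨ FP.firstPresent-shift e' (suc t) (len∣K e') ⟩
      first e' (suc t + K)                      ≤⟨ FP.firstPresent-mono e' cop-late ⟩
      first e' (arrival c' (suc t) (suc j))     ∎
      where
      open ≤-Reasoning
      e' : Fin N
      e' = edge (step r)
      reach-r : iterate step j c' ≡ r
      reach-r = step-injective (trans (sym (iterate-suc step j c')) reach)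
      last-crossing : arrival c' (suc t) (suc j) ≡ suc (first (edge r) (arrival c' (suc t) j))
      last-crossing = trans (arrival-last c' (suc t) j)
                        (cong (λ x → suc (first (edge x) (arrival c' (suc t) j))) reach-r)
      cop-late : suc t + K ≤ arrival c' (suc t) (suc j)
      cop-late with cop-step-arrival cop c'≢r j reach-r
      ... | k , reach₀ , slower = begin
        suc t + K                                           ≡⟨ cong (λ s → suc s + K) (FP.firstPresent-here (edge r) pr) ⟨
        suc (first (edge r) t + K)                          ≤⟨ s≤s (ahead k reach₀) ⟩
        suc (first (edge r) (arrival c t k))                ≤⟨ s≤s (FP.firstPresent-mono (edge r) slower) ⟩
        suc (first (edge r) (arrival c' (suc t) j))         ≡⟨ last-crossing ⟨
        arrival c' (suc t) (suc j)                          ∎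
        where open ≤-Reasoning

    Near : Fin N → Fin N → Set
    Near c r = ∃ λ (i : Fin K) → iterate step (toℕ i) c ≡ r

    near? : ∀ c r → Dec (Near c r)
    near? c r = any? (λ i → iterate step (toℕ i) c ≟ᶠ r)

    ¬near⇒far : ∀ {c r} → ¬ Near c r → Far step c r
    ¬near⇒far {c} {r} ¬near k reach with k <? K
    ... | yes k<K = ⊥-elim (¬near (fromℕ< k<K , subst (λ i → iterate step i c ≡ r) (sym (toℕ-fromℕ< k<K)) reach))
    ... | no k≮K = ≮⇒≥ k≮K

    -- Exactly K steps ahead is far: a shorter walk would close a loop shorter than N.
    far-exactly : ∀ c → Far step c (iterate step K c)
    far-exactly c k reach with k <? K
    ... | no k≮K = ≮⇒≥ k≮K
    ... | yes k<K = ⊥-elim (step-aperiodic y (m<n⇒0<n∸m k<K) (≤-trans (s≤s (m∸n≤m K k)) (≤-trans (m<m+n K 0<K) K+K≤N)) loop)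
      where
      open ≡-Reasoning
      y : Fin N
      y = iterate step k c
      loop : iterate step (K ∸ k) y ≡ y
      loop = begin
        iterate step (K ∸ k) y        ≡⟨ iterate-+ step k (K ∸ k) c ⟨
        iterate step (k + (K ∸ k)) c  ≡⟨ cong (λ j → iterate step j c) (m+[n∸m]≡n (<⇒≤ k<K)) ⟩
        iterate step K c              ≡⟨ reach ⟨
        y                             ∎

    -- If r is 0 < i ≤ K steps ahead of c, then walking backwards from c
    -- takes at least K steps to reach r: otherwise a loop shorter than 2K ≤ N closes.
    far-behind : ∀ {i c r} → 0 < i → i ≤ K → iterate step i c ≡ r → Far back c r
    far-behind {i} {c} {r} 0<i i≤K reach k back-reach with k <? K
    ... | no k≮K = ≮⇒≥ k≮K
    ... | yes k<K = ⊥-elim (step-aperiodic c (≤-trans 0<i (m≤m+n i k)) (≤-trans (+-mono-≤-< i≤K k<K) K+K≤N) loop)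
      where
      loop : iterate step (i + k) c ≡ c
      loop = trans (iterate-+ step i k c)
               (trans (cong (iterate step k) reach) (iterate-undo step back step-back k back-reach))

    flee : ∀ {t c c' r} → Ahead t c r → CopStep t c c' → c' ≢ r → Near c' r → present (τ (edge r)) t →
           step r ≢ c' × Ahead (suc t) c' (step r) × Far back c' (step r)
    flee {t} {c} {c'} {r} ahead cop c'≢r (i , reach) pr =
      ≢-sym (far⇒distinct far) , ahead-cross ahead cop c'≢r pr (far⇒distinct far) , far
      where
      far : Far back c' (step r)
      far = far-behind z<s (toℕ<n i) (trans (iterate-suc step (toℕ i) c') (cong step reach))

    ahead-stay : ∀ {t c c' r} → Ahead t c r → CopStep t c c' → c' ≢ r →
                 ¬ (Near c' r × present (τ (edge r)) t) → Ahead (suc t) c' r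
    ahead-stay {t} {c} {c'} {r} ahead cop c'≢r ¬flee with near? c' r
    ... | yes near = ahead-wait ahead cop c'≢r (λ pr → ¬flee (near , pr))
    ... | no ¬near = far⇒ahead (suc t) (¬near⇒far ¬near)

  module CW = Pursuit clockwise
  module CCW = Pursuit counterclockwise

  Safe : ℕ → Fin N → Fin N → Set
  Safe t c r = CW.Ahead t c r × CCW.Ahead t c r

  move-cw : ∀ {t c c'} → Move τ t c c' → CW.CopStep t c c'
  move-cw (inj₁ refl) = inj₁ refl
  move-cw (inj₂ (e , pe , inj₁ (refl , refl))) = inj₂ (inj₁ (refl , pe))
  move-cw (inj₂ (e , pe , inj₂ (refl , refl))) = inj₂ (inj₂ (sym (prev-next e)))

  move-ccw : ∀ {t c c'} → Move τ t c c' → CCW.CopStep t c c'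
  move-ccw (inj₁ refl) = inj₁ refl
  move-ccw (inj₂ (e , pe , inj₁ (refl , refl))) = inj₂ (inj₂ refl)
  move-ccw {t} (inj₂ (e , pe , inj₂ (refl , refl))) =
    inj₂ (inj₁ (sym (prev-next e) , subst (λ x → present (τ x) t) (sym (prev-next e)) pe))

  safe⇒no-capture : ∀ {t c c' r} → Safe t c r → Move τ t c c' → c' ≢ r
  safe⇒no-capture (cw , _) (inj₁ refl) = CW.ahead⇒distinct cw
  safe⇒no-capture (cw , _) (inj₂ (e , pe , inj₁ (refl , refl))) = CW.ahead⇒no-capture cw pe
  safe⇒no-capture {t} (_ , ccw) (inj₂ (e , pe , inj₂ (refl , refl))) e≡r =
    CCW.ahead⇒no-capture ccw (subst (λ x → present (τ x) t) (sym (prev-next e)) pe) (trans (prev-next e) e≡r)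

  robberMove : ℕ → Fin N → Fin N → Fin N
  robberMove t c' r with CW.near? c' r ×-dec FP.present? r t | CCW.near? c' r ×-dec FP.present? (prev r) t
  ... | yes _ | _     = next r
  ... | no _  | yes _ = prev r
  ... | no _  | no _  = r

  safe-reply : ∀ {t c c' r} → Safe t c r → Move τ t c c' → c' ≢ r →
               let r' = robberMove t c' r in Move τ t r r' × r' ≢ c' × Safe (suc t) c' r'
  safe-reply {t} {c} {c'} {r} (cw , ccw) mv c'≢r
    with CW.near? c' r ×-dec FP.present? r t | CCW.near? c' r ×-dec FP.present? (prev r) t
  ... | yes (near , pr) | _ =
    let (r'≢c' , ahead , far) = CW.flee {t} cw (move-cw {t} mv) c'≢r near pr
    in Direction.step-legal clockwise {t} r pr , r'≢c' , ahead , CCW.far⇒ahead (suc t) far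
  ... | no _ | yes (near , pr) =
    let (r'≢c' , ahead , far) = CCW.flee {t} ccw (move-ccw {t} mv) c'≢r near pr
    in Direction.step-legal counterclockwise {t} r pr , r'≢c' , CW.far⇒ahead (suc t) far , ahead
  ... | no ¬flee-cw | no ¬flee-ccw =
    inj₁ refl , ≢-sym c'≢r ,
    CW.ahead-stay {t} cw (move-cw {t} mv) c'≢r ¬flee-cw , CCW.ahead-stay {t} ccw (move-ccw {t} mv) c'≢r ¬flee-ccw

  robber : RobberStrategy N
  robber t h c' = robberMove t c' (proj₂ (head h))

  safe-throughout : ∀ c₀ r₀ (σ : CopStrategy N) → Safe 0 c₀ r₀ → ∀ t →
    (∀ s → s < t → Move τ s (proj₁ (head (play c₀ r₀ σ robber s))) (σ s (play c₀ r₀ σ robber s))) →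
    Safe t (proj₁ (head (play c₀ r₀ σ robber t))) (proj₂ (head (play c₀ r₀ σ robber t)))
  safe-throughout c₀ r₀ σ safe₀ zero _ = safe₀
  safe-throughout c₀ r₀ σ safe₀ (suc t) legal =
    proj₂ (proj₂ (safe-reply safe-t (legal t ≤-refl) (safe⇒no-capture safe-t (legal t ≤-refl))))
    where
    safe-t : Safe t (proj₁ (head (play c₀ r₀ σ robber t))) (proj₂ (head (play c₀ r₀ σ robber t)))
    safe-t = safe-throughout c₀ r₀ σ safe₀ t (λ s s<t → legal s (m<n⇒m<1+n s<t))

  robber-wins : RobberWin τ
  robber-wins c₀ = r₀ , robber , ≢-sym (far⇒distinct far-ccw) , λ σ t legal →
      let safe-t = safe-throughout c₀ r₀ σ safe₀ t (λ s s<t → legal s (<⇒≤ s<t))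
          c'≢r = safe⇒no-capture safe-t (legal t ≤-refl)
          (legal-reply , r'≢c' , _) = safe-reply safe-t (legal t ≤-refl) c'≢r
      in c'≢r , legal-reply , r'≢c'
    where
    r₀ : Fin N
    r₀ = iterate next K c₀
    far-cw : Far next c₀ r₀
    far-cw = CW.far-exactly c₀
    far-ccw : Far prev c₀ r₀
    far-ccw = CW.far-behind 0<K ≤-refl refl
    safe₀ : Safe 0 c₀ r₀
    safe₀ = CW.far⇒ahead 0 far-cw , CCW.far⇒ahead 0 far-ccw

lcm-positive : ∀ {a b} → 0 < a → 0 < b → 0 < lcm a b
lcm-positive {suc a} {suc b} _ _ = n≢0⇒n>0 (λ lcm≡0 → product≢0 (begin
  suc a * suc b                              ≡⟨ gcd*lcm (suc a) (suc b) ⟨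
  gcd (suc a) (suc b) * lcm (suc a) (suc b)  ≡⟨ cong (gcd (suc a) (suc b) *_) lcm≡0 ⟩
  gcd (suc a) (suc b) * 0                    ≡⟨ *-zeroʳ (gcd (suc a) (suc b)) ⟩
  0                                          ∎))
  where
  open ≡-Reasoning
  product≢0 : suc a * suc b ≢ 0
  product≢0 ()

LCM-positive : ∀ xs → (∀ {x} → x ∈ xs → 0 < x) → 0 < LCM xs
LCM-positive [] _ = z<s
LCM-positive (x ∷ xs) pos = lcm-positive (pos (here refl)) (LCM-positive xs (pos ∘ there))

∈⇒∣LCM : ∀ {x xs} → x ∈ xs → x ∣ LCM xs
∈⇒∣LCM {x} {_ ∷ xs} (here refl) = m∣lcm[m,n] x (LCM xs)
∈⇒∣LCM {x} {y ∷ xs} (there x∈xs) = ∣-trans (∈⇒∣LCM x∈xs) (n∣lcm[m,n] y (LCM xs))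

∈⇒≤maxL : ∀ {x xs} → x ∈ xs → x ≤ maxL xs
∈⇒≤maxL {x} {_ ∷ xs} (here refl) = m≤m⊔n x (maxL xs)
∈⇒≤maxL {x} {y ∷ xs} (there x∈xs) = ≤-trans (∈⇒≤maxL x∈xs) (m≤n⊔m y (maxL xs))

-- The role of ell: each positive member x of L is smaller than ell L · LCM L.
-- If 2 · max L ≤ LCM L then x < 2x ≤ LCM L; otherwise x < 2x ≤ 2 · LCM L.
<ell*LCM : ∀ {L x} → (∀ {y} → y ∈ L → 0 < y) → x ∈ L → x < ell L * LCM L
<ell*LCM {L} {x} pos x∈L with 2 * maxL L ≤ᵇ LCM L in fits
... | true = begin-strict
  x            <⟨ m<m+n x (pos x∈L) ⟩
  x + x        ≤⟨ +-mono-≤ x≤max (≤-trans x≤max (m≤m+n (maxL L) 0)) ⟩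
  2 * maxL L   ≤⟨ ≤ᵇ⇒≤ (2 * maxL L) (LCM L) (subst T (sym fits) tt) ⟩
  LCM L        ≡⟨ *-identityˡ (LCM L) ⟨
  1 * LCM L    ∎
  where
  open ≤-Reasoning
  x≤max : x ≤ maxL L
  x≤max = ∈⇒≤maxL x∈L
... | false = begin-strict
  x            <⟨ m<m+n x (pos x∈L) ⟩
  x + x        ≤⟨ +-mono-≤ x≤lcm (≤-trans x≤lcm (m≤m+n (LCM L) 0)) ⟩
  2 * LCM L    ∎
  where
  open ≤-Reasoning
  x≤lcm : x ≤ LCM L
  x≤lcm = ∣⇒≤ {{>-nonZero (LCM-positive L pos)}} (∈⇒∣LCM x∈L)

-- With K = ell L · LCM L every edge length divides K and is below K, and
-- the hypothesis says 2K ≤ n; so the strategy of Chase wins (an empty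
-- cycle leaves the cop no start vertex).
theorem13 : (n : ℕ) (τ : EdgePeriodicCycle n) →
    2 * ell (lengths τ) * LCM (lengths τ) ≤ n →
    RobberWin τ
theorem13 zero τ _ ()
theorem13 (suc m) τ n-large = Chase.robber-wins m τ K len∣K len<K 2K≤n
  where
  L : List ℕ
  L = lengths τ
  K : ℕ
  K = ell L * LCM L
  len∈L : ∀ e → len (τ e) ∈ L
  len∈L e = ∈-map⁺ (λ e → len (τ e)) (∈-allFin e)
  lengths-positive : ∀ {x} → x ∈ L → 0 < x
  lengths-positive x∈L with ∈-map⁻ (λ e → len (τ e)) x∈L
  ... | _ , _ , refl = z<s
  len∣K : ∀ e → len (τ e) ∣ K
  len∣K e = ∣-trans (∈⇒∣LCM (len∈L e)) (n∣m*n (ell L))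
  len<K : ∀ e → len (τ e) < K
  len<K e = <ell*LCM lengths-positive (len∈L e)
  2K≤n : 2 * K ≤ suc m
  2K≤n = subst (_≤ suc m) (*-assoc 2 (ell L) (LCM L)) n-large
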